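{- Let $\phi$ be a second-order sentence over the vocabulary $\{\le\}\cup\{P_i\mid p_i\in\mathrm{AP}\}$. Then there exists a formula $\mathrm{Tr}(\phi)(\mathfrak a)$ of third-order arithmetic ($\Delta^3_0$), with a free third-order variable $\mathfrak a$ of type $((2))$, such that for all trace sets $T$: $$\mathcal M_T\models\phi\iff(\mathbb N,+,\times,\le,0,1)\models\mathrm{Tr}(\phi)(\mathcal A_T/\mathfrak a).$$
   Context: $\mathrm{AP}=\{p_0,p_1,\dots\}$; a trace is $t\in(2^{\mathrm{AP}})^\omega$, a trace set (team) is a set of traces. $\mathcal M_T$ has domain $T\times\mathbb N$, $(t,n)\le(t',m)$ iff $t=t'$ and $n\le m$, and $P_i=\{(t,j)\mid p_i\in t(j)\}$. Third-order arithmetic: a type is a tuple $\tau=(n_1,\dots,n_k)$ of positive integers; variables $\mathfrak a$ of type $\tau$ range over subsets of $\mathcal P(\mathbb N^{n_1})\times\dots\times\mathcal P(\mathbb N^{n_k})$; the language extends second-order logic over $\{+,\times,0,1,=,\le\}$ by atoms $\mathfrak a(A_1,\dots,A_k)$ ($A_i$ a relation variable of arity $n_i$) and quantification over third-order variables; $\Delta^3_0$ is the set of all such formulas. Encoding of $T$: a trace $t$ is encoded by $S_t=\{(j,k)\in\mathbb N^2\mid p_k\in t(j)\}$, and $\mathcal A_T=\{S_t\mid t\in T\}$, an object of type $((2))$. -}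

module Defs where

open import Level using (Lift; lift; lower) renaming (suc to lsuc; zero to lzero)
open import Data.Nat using (ℕ; suc; _+_; _*_; _≤_)
open import Data.Bool using (Bool; true)
open import Data.Unit using (⊤; tt)
open import Data.Empty using (⊥)
open import Data.Product using (Σ; _×_; _,_; proj₁; proj₂)
open import Data.Sum using (_⊎_)
open import Data.List using (List; []; _∷_)
open import Data.List.NonEmpty using (List⁺; toList) renaming (_∷_ to _∷⁺_)
open import Data.List.Membership.Propositional using (_∈_)
open import Data.List.Relation.Unary.All as All using (All; []; _∷_)
open import Data.Vec as Vec using (Vec)
open import Data.Vec.Relation.Binary.Pointwise.Inductive using (Pointwise)
open import Relation.Binary.PropositionalEquality using (_≡_)

_⇔_ : ∀ {ℓ ℓ'} → Set ℓ → Set ℓ' → Set _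
A ⇔ B = (A → B) × (B → A)

-- A trace t : ℕ → 2^AP, encoded as t j k ≡ true iff p_k ∈ t(j).
Trace : Set
Trace = ℕ → ℕ → Bool

Team : Set₁
Team = Trace → Set

_≈T_ : Trace → Trace → Set
t ≈T t' = ∀ j k → t j k ≡ t' j k

Dom : Team → Set
Dom T = Σ (Σ Trace T) (λ _ → ℕ)

trace : ∀ {T} → Dom T → Trace
trace ((t , _) , _) = t

pos : ∀ {T} → Dom T → ℕ
pos (_ , n) = n

_≈D_ : ∀ {T} → Dom T → Dom T → Set
x ≈D y = (trace x ≈T trace y) × (pos x ≡ pos y)

_≤D_ : ∀ {T} → Dom T → Dom T → Set
x ≤D y = (trace x ≈T trace y) × (pos x ≤ pos y)

PD : ∀ {T} → ℕ → Dom T → Set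
PD i x = trace x (pos x) i ≡ true

RelD : Team → ℕ → Set₁
RelD T n = Σ (Vec (Dom T) (suc n) → Set)
             (λ R → ∀ xs ys → Pointwise _≈D_ xs ys → R xs → R ys)

data Sort : Set where
  ind : Sort
  rel : ℕ → Sort

data SO (Γ : List Sort) : Set where
  leq  : ind ∈ Γ → ind ∈ Γ → SO Γ
  eq   : ind ∈ Γ → ind ∈ Γ → SO Γ
  prop : ℕ → ind ∈ Γ → SO Γ
  app  : ∀ {n} → rel n ∈ Γ → Vec (ind ∈ Γ) (suc n) → SO Γ
  ¬'_  : SO Γ → SO Γ
  _∧'_ : SO Γ → SO Γ → SO Γ
  _∨'_ : SO Γ → SO Γ → SO Γ
  _⇒'_ : SO Γ → SO Γ → SO Γ
  ∃'   : (s : Sort) → SO (s ∷ Γ) → SO Γ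
  ∀'   : (s : Sort) → SO (s ∷ Γ) → SO Γ

SOSentence : Set
SOSentence = SO []

SemS : Team → Sort → Set₁
SemS T ind     = Lift (lsuc lzero) (Dom T)
SemS T (rel n) = RelD T n

EnvS : Team → List Sort → Set₁
EnvS T Γ = All (SemS T) Γ

elt : ∀ {T Γ} → EnvS T Γ → ind ∈ Γ → Dom T
elt ρ x = lower (All.lookup ρ x)

satS : (T : Team) → ∀ {Γ} → SO Γ → EnvS T Γ → Set₁
satS T (leq x y)   ρ = Lift _ (elt ρ x ≤D elt ρ y)
satS T (eq x y)    ρ = Lift _ (elt ρ x ≈D elt ρ y)
satS T (prop i x)  ρ = Lift _ (PD i (elt ρ x))
satS T (app r xs)  ρ = Lift _ (proj₁ (All.lookup ρ r) (Vec.map (elt ρ) xs))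
satS T (¬' φ)      ρ = satS T φ ρ → ⊥
satS T (φ ∧' ψ)    ρ = satS T φ ρ × satS T ψ ρ
satS T (φ ∨' ψ)    ρ = satS T φ ρ ⊎ satS T ψ ρ
satS T (φ ⇒' ψ)    ρ = satS T φ ρ → satS T ψ ρ
satS T (∃' s φ)    ρ = Σ (SemS T s) (λ d → satS T φ (d ∷ ρ))
satS T (∀' s φ)    ρ = (d : SemS T s) → satS T φ (d ∷ ρ)

_⊨S_ : Team → SOSentence → Set₁
T ⊨S φ = satS T φ []

NRel : ℕ → Set₁
NRel n = Vec ℕ (suc n) → Set

Tuple : List ℕ → Set₁
Tuple []      = Lift _ ⊤
Tuple (n ∷ τ) = NRel n × Tuple τ

EqTuple : (τ : List ℕ) → Tuple τ → Tuple τ → Set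
EqTuple []      _        _        = ⊤
EqTuple (n ∷ τ) (A , as) (B , bs) = (∀ v → A v ⇔ B v) × EqTuple τ as bs

-- Third-order objects of type τ = (n₁+1,…,n_k+1): sets of tuples
-- (extensional predicates on tuples of relations).
Third : List⁺ ℕ → Set₁
Third τ = Σ (Tuple (toList τ) → Set)
            (λ 𝔞 → ∀ as bs → EqTuple (toList τ) as bs → 𝔞 as → 𝔞 bs)

data Sort3 : Set where
  num   : Sort3
  rel   : ℕ → Sort3
  third : List⁺ ℕ → Sort3

data Term (Γ : List Sort3) : Set where
  var  : num ∈ Γ → Term Γ
  zero' one' : Term Γ
  _+'_ _*'_ : Term Γ → Term Γ → Term Γ

Args : List Sort3 → List ℕ → Set
Args Γ []      = ⊤
Args Γ (n ∷ τ) = (rel n ∈ Γ) × Args Γ τ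

data A3 (Γ : List Sort3) : Set where
  eq    : Term Γ → Term Γ → A3 Γ
  leq   : Term Γ → Term Γ → A3 Γ
  app   : ∀ {n} → rel n ∈ Γ → Vec (Term Γ) (suc n) → A3 Γ
  app3  : ∀ {τ} → third τ ∈ Γ → Args Γ (toList τ) → A3 Γ
  ¬'_   : A3 Γ → A3 Γ
  _∧'_  : A3 Γ → A3 Γ → A3 Γ
  _∨'_  : A3 Γ → A3 Γ → A3 Γ
  _⇒'_  : A3 Γ → A3 Γ → A3 Γ
  ∃'    : (s : Sort3) → A3 (s ∷ Γ) → A3 Γ
  ∀'    : (s : Sort3) → A3 (s ∷ Γ) → A3 Γ

Sem3 : Sort3 → Set₁
Sem3 num       = Lift (lsuc lzero) ℕ
Sem3 (rel n)   = NRel n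
Sem3 (third τ) = Third τ

Env3 : List Sort3 → Set₁
Env3 Γ = All Sem3 Γ

evalT : ∀ {Γ} → Env3 Γ → Term Γ → ℕ
evalT ρ (var x)  = lower (All.lookup ρ x)
evalT ρ zero'    = 0
evalT ρ one'     = 1
evalT ρ (s +' t) = evalT ρ s + evalT ρ t
evalT ρ (s *' t) = evalT ρ s * evalT ρ t

evalArgs : ∀ {Γ} → Env3 Γ → (τ : List ℕ) → Args Γ τ → Tuple τ
evalArgs ρ []      _        = lift tt
evalArgs ρ (n ∷ τ) (r , rs) = All.lookup ρ r , evalArgs ρ τ rs

sat3 : ∀ {Γ} → A3 Γ → Env3 Γ → Set₁
sat3 (eq s t)     ρ = Lift _ (evalT ρ s ≡ evalT ρ t)
sat3 (leq s t)    ρ = Lift _ (evalT ρ s ≤ evalT ρ t)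
sat3 (app r ts)   ρ = Lift _ (All.lookup ρ r (Vec.map (evalT ρ) ts))
sat3 (app3 {τ} a rs) ρ = Lift _ (proj₁ (All.lookup ρ a) (evalArgs ρ (toList τ) rs))
sat3 (¬' ψ)       ρ = sat3 ψ ρ → ⊥
sat3 (ψ ∧' χ)     ρ = sat3 ψ ρ × sat3 χ ρ
sat3 (ψ ∨' χ)     ρ = sat3 ψ ρ ⊎ sat3 χ ρ
sat3 (ψ ⇒' χ)     ρ = sat3 ψ ρ → sat3 χ ρ
sat3 (∃' s ψ)     ρ = Σ (Sem3 s) (λ d → sat3 ψ (d ∷ ρ))
sat3 (∀' s ψ)     ρ = (d : Sem3 s) → sat3 ψ (d ∷ ρ)

-- the type ((2)) : one relation of arity 2 (= suc 1)
τ22 : List⁺ ℕ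
τ22 = 1 ∷⁺ []

S : Trace → NRel 1
S t v = t (Vec.head v) (Vec.head (Vec.tail v)) ≡ true

𝒜 : Team → Third τ22
𝒜 T = (λ { (A , _) → Σ Trace (λ t → T t × (∀ v → A v ⇔ S t v)) })
    , λ { (A , _) (B , _) (AB , _) (t , tT , At) →
            t , tT , (λ v → (λ b → proj₁ (At v) (proj₂ (AB v) b))
                          , (λ s → proj₁ (AB v) (proj₂ (At v) s))) }

Ctx𝔞 : List Sort3
Ctx𝔞 = third τ22 ∷ []

-- An element (t , n) of M_T is coded by the pair of relations (S_t , {n}). A pair (A , N)
-- is such a code exactly when A ∈ 𝔞 and N is a singleton, which is first-order expressible
-- in 𝔞; codes determine elements up to identity and every element has one. An (n+1)-ary
-- relation on M_T corresponds to the third-order object of type (2,1,…,2,1) collecting the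
-- codes of its tuples, and every third-order object of that type is, up to extensionality,
-- of this form. So element and relation quantifiers translate into quantifiers over codes
-- and over third-order objects, and the translation is correct by induction on φ.
module Submission where

open import Defs
open import Level using (Level; Lift; lift; lower)
open import Data.Nat using (ℕ; zero; suc; _≤_)
open import Data.Bool using (Bool; true; false)
open import Data.Unit using (⊤; tt)
open import Data.Empty using (⊥)
open import Data.Product using (Σ; _×_; _,_; proj₁; proj₂)
open import Data.Sum using (_⊎_; inj₁; inj₂)
open import Data.List using (List; []; _∷_)
open import Data.List.NonEmpty using (List⁺) renaming (_∷_ to _∷⁺_)
open import Data.List.Relation.Unary.Any using (here; there)
open import Data.List.Membership.Propositional using (_∈_)
open import Data.List.Relation.Unary.All as All using ([]; _∷_)
open import Data.Vec as Vec using (Vec; []; _∷_)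
open import Data.Vec.Relation.Binary.Pointwise.Inductive using (Pointwise; []; _∷_)
open import Relation.Binary.PropositionalEquality
  using (_≡_; refl; sym; trans; cong; subst; subst₂)

private
  variable
    a b c d : Level
    A B C D : Set a

⇔-refl : A ⇔ A
⇔-refl = (λ x → x) , (λ x → x)

⇔-sym : A ⇔ B → B ⇔ A
⇔-sym (f , g) = g , f

⇔-trans : A ⇔ B → B ⇔ C → A ⇔ C
⇔-trans (f , g) (h , k) = (λ x → h (f x)) , (λ z → g (k z))

Lift-⇔ : Lift c A ⇔ A
Lift-⇔ = lower , lift

Lift-cong : A ⇔ B → Lift c A ⇔ Lift d B
Lift-cong A⇔B = ⇔-trans Lift-⇔ (⇔-trans A⇔B (⇔-sym Lift-⇔))

Lift-cong⁻¹ : Lift c A ⇔ Lift d B → A ⇔ B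
Lift-cong⁻¹ A⇔B = ⇔-trans (⇔-sym Lift-⇔) (⇔-trans A⇔B Lift-⇔)

×-cong : A ⇔ B → C ⇔ D → (A × C) ⇔ (B × D)
×-cong (f , g) (h , k) = (λ (x , z) → f x , h z) , (λ (y , w) → g y , k w)

⊎-cong : A ⇔ B → C ⇔ D → (A ⊎ C) ⇔ (B ⊎ D)
⊎-cong (f , g) (h , k) =
  (λ { (inj₁ x) → inj₁ (f x) ; (inj₂ z) → inj₂ (h z) }) ,
  (λ { (inj₁ y) → inj₁ (g y) ; (inj₂ w) → inj₂ (k w) })

→-cong : A ⇔ B → C ⇔ D → (A → C) ⇔ (B → D)
→-cong (f , g) (h , k) = (λ u y → h (u (g y))) , (λ v x → k (v (f x)))

¬-cong : A ⇔ B → (A → ⊥) ⇔ (B → ⊥)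
¬-cong A⇔B = →-cong A⇔B ⇔-refl

module _ {X : Set a} {Y : Set b} (R : X → Y → Set c)
         (forth : ∀ x → Σ Y (R x)) (back : ∀ y → Σ X (λ x → R x y))
         {P : X → Set d} {Q : Y → Set d} (P⇔Q : ∀ {x y} → R x y → P x ⇔ Q y) where

  Σ-cong-along : Σ X P ⇔ Σ Y Q
  Σ-cong-along =
    (λ (x , p) → let (y , r) = forth x in y , proj₁ (P⇔Q r) p) ,
    (λ (y , q) → let (x , r) = back y in x , proj₂ (P⇔Q r) q)

  Π-cong-along : ((x : X) → P x) ⇔ ((y : Y) → Q y)
  Π-cong-along =
    (λ f y → let (x , r) = back y in proj₁ (P⇔Q r) (f x)) ,
    (λ g x → let (y , r) = forth x in proj₂ (P⇔Q r) (g y))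

true-⇔⇒≡ : {x y : Bool} → (x ≡ true) ⇔ (y ≡ true) → x ≡ y
true-⇔⇒≡ {false} {false} _       = refl
true-⇔⇒≡ {false} {true}  (_ , g) = g refl
true-⇔⇒≡ {true}  {false} (f , _) = sym (f refl)
true-⇔⇒≡ {true}  {true}  _       = refl

infix 4 _≐_

_≐_ : ∀ {n} → NRel n → NRel n → Set
R ≐ R′ = ∀ v → R v ⇔ R′ v

≐-sym : ∀ {n} {R R′ : NRel n} → R ≐ R′ → R′ ≐ R
≐-sym R≐R′ v = ⇔-sym (R≐R′ v)

≐-trans : ∀ {n} {R R′ R″ : NRel n} → R ≐ R′ → R′ ≐ R″ → R ≐ R″
≐-trans R≐R′ R′≐R″ v = ⇔-trans (R≐R′ v) (R′≐R″ v)

Singleton : ℕ → NRel 0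
Singleton n v = Vec.head v ≡ n

≐-cong : ∀ {n} {R R′ Q Q′ : NRel n} → R ≐ R′ → Q ≐ Q′ → (R ≐ Q) ⇔ (R′ ≐ Q′)
≐-cong R≐R′ Q≐Q′ = (λ R≐Q → ≐-trans (≐-sym R≐R′) (≐-trans R≐Q Q≐Q′))
                 , (λ R′≐Q′ → ≐-trans R≐R′ (≐-trans R′≐Q′ (≐-sym Q≐Q′)))

S-≐⇔≈T : ∀ {s t} → (S s ≐ S t) ⇔ (s ≈T t)
S-≐⇔≈T = (λ S≐S j k → true-⇔⇒≡ (S≐S (j ∷ k ∷ [])))
       , (λ { s≈t (j ∷ k ∷ []) → subst (λ b → (_ ≡ true) ⇔ (b ≡ true)) (s≈t j k) ⇔-refl })

Singleton-≐⇔≡ : ∀ {m n} → (Singleton m ≐ Singleton n) ⇔ (m ≡ n)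
Singleton-≐⇔≡ {m} = (λ m≐n → proj₁ (m≐n (m ∷ [])) refl)
                  , (λ { refl v → ⇔-refl })

-- Arities are stored minus one: each 1 ∷ 0 is the code (S_t , {n}) of one element,
-- so tupleType n is the paper's type (2,1,…,2,1) with n+1 pairs.

codesType : ℕ → List ℕ
codesType zero    = []
codesType (suc m) = 1 ∷ 0 ∷ codesType m

tupleType : ℕ → List⁺ ℕ
tupleType n = 1 ∷⁺ 0 ∷ codesType n

trCtx : List Sort → List Sort3
trCtx []          = Ctx𝔞
trCtx (ind ∷ Γ)   = rel 0 ∷ rel 1 ∷ trCtx Γ
trCtx (rel n ∷ Γ) = third (tupleType n) ∷ trCtx Γ

teamVar : ∀ Γ → third τ22 ∈ trCtx Γ
teamVar []          = here refl
teamVar (ind ∷ Γ)   = there (there (teamVar Γ))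
teamVar (rel n ∷ Γ) = there (teamVar Γ)

traceVar : ∀ {Γ} → ind ∈ Γ → rel 1 ∈ trCtx Γ
traceVar {ind ∷ Γ}   (here refl) = there (here refl)
traceVar {ind ∷ Γ}   (there x)   = there (there (traceVar x))
traceVar {rel n ∷ Γ} (there x)   = there (traceVar x)

posVar : ∀ {Γ} → ind ∈ Γ → rel 0 ∈ trCtx Γ
posVar {ind ∷ Γ}   (here refl) = here refl
posVar {ind ∷ Γ}   (there x)   = there (there (posVar x))
posVar {rel n ∷ Γ} (there x)   = there (posVar x)

relVar : ∀ {Γ n} → rel n ∈ Γ → third (tupleType n) ∈ trCtx Γ
relVar {ind ∷ Γ}   (there r)   = there (there (relVar r))
relVar {rel m ∷ Γ} (here refl) = here refl
relVar {rel m ∷ Γ} (there r)   = there (relVar r)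

trArgs : ∀ {Γ m} → Vec (ind ∈ Γ) m → Args (trCtx Γ) (codesType m)
trArgs []       = tt
trArgs (x ∷ xs) = traceVar x , posVar x , trArgs xs

#0 : ∀ {Δ} → Term (num ∷ Δ)
#0 = var (here refl)

#1 : ∀ {s Δ} → Term (s ∷ num ∷ Δ)
#1 = var (there (here refl))

infixr 2 _⇔′_

_⇔′_ : ∀ {Δ} → A3 Δ → A3 Δ → A3 Δ
ψ ⇔′ χ = (ψ ⇒' χ) ∧' (χ ⇒' ψ)

numeral : ∀ {Δ} → ℕ → Term Δ
numeral zero    = zero'
numeral (suc i) = one' +' numeral i

sameTraceF : ∀ {Δ} → rel 1 ∈ Δ → rel 1 ∈ Δ → A3 Δ
sameTraceF s t = ∀' num (∀' num (app (there (there s)) (#1 ∷ #0 ∷ [])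
                               ⇔′ app (there (there t)) (#1 ∷ #0 ∷ [])))

samePosF : ∀ {Δ} → rel 0 ∈ Δ → rel 0 ∈ Δ → A3 Δ
samePosF p q = ∃' num (app (there p) (#0 ∷ []) ∧' app (there q) (#0 ∷ []))

posLeqF : ∀ {Δ} → rel 0 ∈ Δ → rel 0 ∈ Δ → A3 Δ
posLeqF p q = ∃' num (∃' num ((app (there (there p)) (#1 ∷ [])
                            ∧' app (there (there q)) (#0 ∷ [])) ∧' leq #1 #0))

holdsF : ∀ {Δ} → ℕ → rel 1 ∈ Δ → rel 0 ∈ Δ → A3 Δ
holdsF i t p = ∃' num (app (there p) (#0 ∷ []) ∧' app (there t) (#0 ∷ numeral i ∷ []))

singletonF : ∀ {Δ} → rel 0 ∈ Δ → A3 Δ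
singletonF p = ∃' num (∀' num (app (there (there p)) (#0 ∷ []) ⇔′ eq #0 #1))

elementCodeF : ∀ {Δ} → third τ22 ∈ Δ → rel 1 ∈ Δ → rel 0 ∈ Δ → A3 Δ
elementCodeF 𝔞 t p = app3 𝔞 (t , tt) ∧' singletonF p

isElementCodeF : ∀ Γ → A3 (rel 0 ∷ rel 1 ∷ trCtx Γ)
isElementCodeF Γ = elementCodeF (there (there (teamVar Γ))) (there (here refl)) (here refl)

trF : ∀ {Γ} → SO Γ → A3 (trCtx Γ)
trF (leq x y)  = sameTraceF (traceVar x) (traceVar y) ∧' posLeqF (posVar x) (posVar y)
trF (eq x y)   = sameTraceF (traceVar x) (traceVar y) ∧' samePosF (posVar x) (posVar y)
trF (prop i x) = holdsF i (traceVar x) (posVar x)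
trF (app r xs) = app3 (relVar r) (trArgs xs)
trF (¬' φ)     = ¬' trF φ
trF (φ ∧' ψ)   = trF φ ∧' trF ψ
trF (φ ∨' ψ)   = trF φ ∨' trF ψ
trF (φ ⇒' ψ)   = trF φ ⇒' trF ψ
trF {Γ} (∃' ind φ) = ∃' (rel 1) (∃' (rel 0) (isElementCodeF Γ ∧' trF φ))
trF {Γ} (∀' ind φ) = ∀' (rel 1) (∀' (rel 0) (isElementCodeF Γ ⇒' trF φ))
trF (∃' (rel n) φ) = ∃' (third (tupleType n)) (trF φ)
trF (∀' (rel n) φ) = ∀' (third (tupleType n)) (trF φ)

numeral-value : ∀ {Δ} (ρ : Env3 Δ) i → evalT ρ (numeral i) ≡ i
numeral-value ρ zero    = refl
numeral-value ρ (suc i) = cong suc (numeral-value ρ i)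

module _ {Δ} (ρ : Env3 Δ) where

  sameTraceF-correct : ∀ s t {u v} → All.lookup ρ s ≐ S u → All.lookup ρ t ≐ S v →
                       sat3 (sameTraceF s t) ρ ⇔ (u ≈T v)
  sameTraceF-correct s t s≐u t≐v = ⇔-trans sat⇔≐ (⇔-trans (≐-cong s≐u t≐v) S-≐⇔≈T)
    where
    sat⇔≐ : sat3 (sameTraceF s t) ρ ⇔ (All.lookup ρ s ≐ All.lookup ρ t)
    sat⇔≐ = (λ { f (j ∷ k ∷ []) → Lift-cong⁻¹ (f (lift j) (lift k)) })
          , (λ s≐t (lift j) (lift k) → Lift-cong (s≐t (j ∷ k ∷ [])))

  samePosF-correct : ∀ p q {m n} → All.lookup ρ p ≐ Singleton m → All.lookup ρ q ≐ Singleton n →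
                     sat3 (samePosF p q) ρ ⇔ (m ≡ n)
  samePosF-correct p q p≐m q≐n =
    (λ (lift k , lift x , lift y) → trans (sym (proj₁ (p≐m _) x)) (proj₁ (q≐n _) y))
    , (λ { refl → lift _ , lift (proj₂ (p≐m _) refl) , lift (proj₂ (q≐n _) refl) })

  posLeqF-correct : ∀ p q {m n} → All.lookup ρ p ≐ Singleton m → All.lookup ρ q ≐ Singleton n →
                    sat3 (posLeqF p q) ρ ⇔ (m ≤ n)
  posLeqF-correct p q p≐m q≐n =
    (λ (lift k , lift l , (lift x , lift y) , lift k≤l) →
       subst₂ _≤_ (proj₁ (p≐m _) x) (proj₁ (q≐n _) y) k≤l)
    , (λ m≤n → lift _ , lift _ , (lift (proj₂ (p≐m _) refl) , lift (proj₂ (q≐n _) refl)) , lift m≤n)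

  holdsF-correct : ∀ i t p {u n} → All.lookup ρ t ≐ S u → All.lookup ρ p ≐ Singleton n →
                   sat3 (holdsF i t p) ρ ⇔ (u n i ≡ true)
  holdsF-correct i t p {u} {n} t≐u p≐n =
    (λ (lift k , lift x , lift y) →
       subst₂ (λ k′ i′ → u k′ i′ ≡ true) (proj₁ (p≐n _) x) (numeral-value _ i) (proj₁ (t≐u _) y))
    , (λ h → lift n , lift (proj₂ (p≐n _) refl)
           , lift (proj₂ (t≐u _) (subst (λ i′ → u n i′ ≡ true) (sym (numeral-value _ i)) h)))

  singletonF-correct : ∀ p → sat3 (singletonF p) ρ ⇔ Σ ℕ (λ n → All.lookup ρ p ≐ Singleton n)
  singletonF-correct p =
    (λ { (lift n , f) → n , λ { (m ∷ []) → Lift-cong⁻¹ (f (lift m)) } })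
    , (λ (n , p≐n) → lift n , λ (lift m) → Lift-cong (p≐n (m ∷ [])))

module Correctness (T : Team) where

  record Encodes (d : Dom T) (A : NRel 1) (N : NRel 0) : Set where
    constructor encodes
    field
      trace≐ : A ≐ S (trace d)
      pos≐   : N ≐ Singleton (pos d)

  open Encodes

  encodes-code : ∀ d → Encodes d (S (trace d)) (Singleton (pos d))
  encodes-code d = encodes (λ v → ⇔-refl) (λ v → ⇔-refl)

  encodes-unique : ∀ {d e A N} → Encodes d A N → Encodes e A N → d ≈D e
  encodes-unique (encodes A≐d N≐d) (encodes A≐e N≐e) =
    proj₁ S-≐⇔≈T (≐-trans (≐-sym A≐d) A≐e) , proj₁ Singleton-≐⇔≡ (≐-trans (≐-sym N≐d) N≐e)

  encodes-agree : ∀ {d A N B M} → Encodes d A N → Encodes d B M → (A ≐ B) × (N ≐ M)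
  encodes-agree (encodes A≐d N≐d) (encodes B≐d M≐d) =
    ≐-trans A≐d (≐-sym B≐d) , ≐-trans N≐d (≐-sym M≐d)

  encodes-resp-≐ : ∀ {d A N B M} → A ≐ B → N ≐ M → Encodes d A N → Encodes d B M
  encodes-resp-≐ A≐B N≐M (encodes A≐d N≐d) =
    encodes (≐-trans (≐-sym A≐B) A≐d) (≐-trans (≐-sym N≐M) N≐d)

  encodes-resp-≈D : ∀ {d e A N} → d ≈D e → Encodes d A N → Encodes e A N
  encodes-resp-≈D (t≈ , p≡) (encodes A≐d N≐d) =
    encodes (≐-trans A≐d (proj₂ S-≐⇔≈T t≈)) (≐-trans N≐d (proj₂ Singleton-≐⇔≡ p≡))

  EncodesAll : ∀ {m} → Tuple (codesType m) → Vec (Dom T) m → Set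
  EncodesAll _           []       = ⊤
  EncodesAll (A , N , as) (d ∷ ds) = Encodes d A N × EncodesAll as ds

  codes : ∀ {m} → Vec (Dom T) m → Tuple (codesType m)
  codes []       = lift tt
  codes (d ∷ ds) = S (trace d) , Singleton (pos d) , codes ds

  encodesAll-codes : ∀ {m} (ds : Vec (Dom T) m) → EncodesAll (codes ds) ds
  encodesAll-codes []       = tt
  encodesAll-codes (d ∷ ds) = encodes-code d , encodesAll-codes ds

  encodesAll-unique : ∀ {m} as (ds es : Vec (Dom T) m) →
                      EncodesAll as ds → EncodesAll as es → Pointwise _≈D_ ds es
  encodesAll-unique _           []       []       _         _         = []
  encodesAll-unique (_ , _ , as) (d ∷ ds) (e ∷ es) (cd , cds) (ce , ces) =
    encodes-unique cd ce ∷ encodesAll-unique as ds es cds ces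

  encodesAll-agree : ∀ {m} as bs (ds : Vec (Dom T) m) →
                     EncodesAll as ds → EncodesAll bs ds → EqTuple (codesType m) as bs
  encodesAll-agree _           _           []       _         _         = tt
  encodesAll-agree (_ , _ , as) (_ , _ , bs) (d ∷ ds) (ca , cas) (cb , cbs) =
    let (A≐B , N≐M) = encodes-agree ca cb in A≐B , N≐M , encodesAll-agree as bs ds cas cbs

  encodesAll-resp-EqTuple : ∀ {m} as bs (ds : Vec (Dom T) m) →
                            EqTuple (codesType m) as bs → EncodesAll as ds → EncodesAll bs ds
  encodesAll-resp-EqTuple _           _           []       _                 _          = tt
  encodesAll-resp-EqTuple (_ , _ , as) (_ , _ , bs) (d ∷ ds) (A≐B , N≐M , eqs) (cd , cds) =
    encodes-resp-≐ A≐B N≐M cd , encodesAll-resp-EqTuple as bs ds eqs cds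

  encodesAll-resp-≈D : ∀ {m} as (ds es : Vec (Dom T) m) →
                       Pointwise _≈D_ ds es → EncodesAll as ds → EncodesAll as es
  encodesAll-resp-≈D _           []       []       []           _          = tt
  encodesAll-resp-≈D (_ , _ , as) (d ∷ ds) (e ∷ es) (d≈e ∷ ds≈es) (cd , cds) =
    encodes-resp-≈D d≈e cd , encodesAll-resp-≈D as ds es ds≈es cds

  RelCorr : ∀ n → RelD T n → Third (tupleType n) → Set₁
  RelCorr n R 𝔯 = ∀ ds as → EncodesAll as ds → proj₁ R ds ⇔ proj₁ 𝔯 as

  relToThird : ∀ {n} → RelD T n → Third (tupleType n)
  relToThird R = (λ as → Σ (Vec (Dom T) _) (λ ds → EncodesAll as ds × proj₁ R ds))
               , (λ as bs as≐bs (ds , cds , r) → ds , encodesAll-resp-EqTuple as bs ds as≐bs cds , r)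

  relToThird-corr : ∀ {n} (R : RelD T n) → RelCorr n R (relToThird R)
  relToThird-corr R ds as cds =
    (λ r → ds , cds , r)
    , (λ (es , ces , r) → proj₂ R es ds (encodesAll-unique as es ds ces cds) r)

  thirdToRel : ∀ {n} → Third (tupleType n) → RelD T n
  thirdToRel 𝔯 = (λ ds → proj₁ 𝔯 (codes ds))
               , (λ ds es ds≈es → proj₂ 𝔯 (codes ds) (codes es)
                    (encodesAll-agree (codes ds) (codes es) es
                       (encodesAll-resp-≈D (codes ds) ds es ds≈es (encodesAll-codes ds))
                       (encodesAll-codes es)))

  thirdToRel-corr : ∀ {n} (𝔯 : Third (tupleType n)) → RelCorr n (thirdToRel 𝔯) 𝔯
  thirdToRel-corr 𝔯 ds as cds =
    proj₂ 𝔯 (codes ds) as (encodesAll-agree (codes ds) as ds (encodesAll-codes ds) cds)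
    , proj₂ 𝔯 as (codes ds) (encodesAll-agree as (codes ds) ds cds (encodesAll-codes ds))

  infixr 5 _∷ᵢ_ _∷ᵣ_

  data EnvCorr : ∀ {Γ} → EnvS T Γ → Env3 (trCtx Γ) → Set₁ where
    []   : EnvCorr [] (𝒜 T ∷ [])
    _∷ᵢ_ : ∀ {Γ ρ ρ′ d A N} → Encodes d A N → EnvCorr {Γ} ρ ρ′ →
           EnvCorr {ind ∷ Γ} (lift d ∷ ρ) (N ∷ A ∷ ρ′)
    _∷ᵣ_ : ∀ {Γ ρ ρ′ n R 𝔯} → RelCorr n R 𝔯 → EnvCorr {Γ} ρ ρ′ →
           EnvCorr {rel n ∷ Γ} (R ∷ ρ) (𝔯 ∷ ρ′)

  private
    variable
      Γ : List Sort
      ρ : EnvS T Γ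
      ρ′ : Env3 (trCtx Γ)

  teamVar-lookup : EnvCorr {Γ} ρ ρ′ → All.lookup ρ′ (teamVar Γ) ≡ 𝒜 T
  teamVar-lookup []        = refl
  teamVar-lookup (_ ∷ᵢ c) = teamVar-lookup c
  teamVar-lookup (_ ∷ᵣ c) = teamVar-lookup c

  encodes-lookup : EnvCorr ρ ρ′ → (x : ind ∈ Γ) →
                   Encodes (elt ρ x) (All.lookup ρ′ (traceVar x)) (All.lookup ρ′ (posVar x))
  encodes-lookup (e ∷ᵢ _) (here refl) = e
  encodes-lookup (_ ∷ᵢ c) (there x)   = encodes-lookup c x
  encodes-lookup (_ ∷ᵣ c) (there x)   = encodes-lookup c x

  relCorr-lookup : EnvCorr ρ ρ′ → ∀ {n} (r : rel n ∈ Γ) →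
                   RelCorr n (All.lookup ρ r) (All.lookup ρ′ (relVar r))
  relCorr-lookup (_ ∷ᵢ c) (there r)   = relCorr-lookup c r
  relCorr-lookup (e ∷ᵣ _) (here refl) = e
  relCorr-lookup (_ ∷ᵣ c) (there r)   = relCorr-lookup c r

  encodesAll-lookup : EnvCorr ρ ρ′ → ∀ {m} (xs : Vec (ind ∈ Γ) m) →
                      EncodesAll (evalArgs ρ′ (codesType m) (trArgs xs)) (Vec.map (elt ρ) xs)
  encodesAll-lookup c []       = tt
  encodesAll-lookup c (x ∷ xs) = encodes-lookup c x , encodesAll-lookup c xs

  isElementCodeF-correct : EnvCorr {Γ} ρ ρ′ → ∀ A N →
                           sat3 (isElementCodeF Γ) (N ∷ A ∷ ρ′) ⇔ Σ (Dom T) (λ d → Encodes d A N)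
  isElementCodeF-correct {Γ = Γ} {ρ′ = ρ′} c A N =
    ⇔-trans (×-cong (⇔-trans Lift-⇔ team-member) (singletonF-correct (N ∷ A ∷ ρ′) (here refl)))
            ((λ ((t , t∈T , A≐t) , n , N≐n) → ((t , t∈T) , n) , encodes A≐t N≐n)
            , (λ (((t , t∈T) , n) , encodes A≐t N≐n) → (t , t∈T , A≐t) , n , N≐n))
    where
    team-member : proj₁ (All.lookup ρ′ (teamVar Γ)) (A , lift tt) ⇔ proj₁ (𝒜 T) (A , lift tt)
    team-member = subst (λ 𝔞 → proj₁ 𝔞 (A , lift tt) ⇔ proj₁ (𝒜 T) (A , lift tt))
                        (sym (teamVar-lookup c)) ⇔-refl

  translate-correct : ∀ {Γ} (φ : SO Γ) {ρ ρ′} → EnvCorr ρ ρ′ → satS T φ ρ ⇔ sat3 (trF φ) ρ′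
  translate-correct (leq x y) {ρ′ = ρ′} c =
    let ex = encodes-lookup c x ; ey = encodes-lookup c y in
    ⇔-trans Lift-⇔ (×-cong (⇔-sym (sameTraceF-correct ρ′ _ _ (trace≐ ex) (trace≐ ey)))
                           (⇔-sym (posLeqF-correct ρ′ _ _ (pos≐ ex) (pos≐ ey))))
  translate-correct (eq x y) {ρ′ = ρ′} c =
    let ex = encodes-lookup c x ; ey = encodes-lookup c y in
    ⇔-trans Lift-⇔ (×-cong (⇔-sym (sameTraceF-correct ρ′ _ _ (trace≐ ex) (trace≐ ey)))
                           (⇔-sym (samePosF-correct ρ′ _ _ (pos≐ ex) (pos≐ ey))))
  translate-correct (prop i x) {ρ} {ρ′} c =
    let ex = encodes-lookup c x in
    ⇔-trans Lift-⇔ (⇔-sym (holdsF-correct ρ′ i _ _ {u = trace (elt ρ x)} (trace≐ ex) (pos≐ ex)))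
  translate-correct (app r xs) c =
    Lift-cong (relCorr-lookup c r _ _ (encodesAll-lookup c xs))
  translate-correct (¬' φ)   c = ¬-cong (translate-correct φ c)
  translate-correct (φ ∧' ψ) c = ×-cong (translate-correct φ c) (translate-correct ψ c)
  translate-correct (φ ∨' ψ) c = ⊎-cong (translate-correct φ c) (translate-correct ψ c)
  translate-correct (φ ⇒' ψ) c = →-cong (translate-correct φ c) (translate-correct ψ c)
  translate-correct (∃' ind φ) c =
    (λ (lift d , s) → S (trace d) , Singleton (pos d)
                    , proj₂ (isElementCodeF-correct c _ _) (d , encodes-code d)
                    , proj₁ (translate-correct φ (encodes-code d ∷ᵢ c)) s)
    , (λ (A , N , g , s) → let (d , e) = proj₁ (isElementCodeF-correct c A N) g in
                           lift d , proj₂ (translate-correct φ (e ∷ᵢ c)) s)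
  translate-correct (∀' ind φ) c =
    (λ f A N g → let (d , e) = proj₁ (isElementCodeF-correct c A N) g in
                 proj₁ (translate-correct φ (e ∷ᵢ c)) (f (lift d)))
    , (λ h (lift d) → proj₂ (translate-correct φ (encodes-code d ∷ᵢ c))
                        (h _ _ (proj₂ (isElementCodeF-correct c _ _) (d , encodes-code d))))
  translate-correct (∃' (rel n) φ) c =
    Σ-cong-along (RelCorr n) (λ R → relToThird R , relToThird-corr R)
                 (λ 𝔯 → thirdToRel 𝔯 , thirdToRel-corr 𝔯) (λ r → translate-correct φ (r ∷ᵣ c))
  translate-correct (∀' (rel n) φ) c =
    Π-cong-along (RelCorr n) (λ R → relToThird R , relToThird-corr R)
                 (λ 𝔯 → thirdToRel 𝔯 , thirdToRel-corr 𝔯) (λ r → translate-correct φ (r ∷ᵣ c))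

theorem4 : (φ : SOSentence) →
    Σ (A3 Ctx𝔞) (λ Trφ → (T : Team) → (T ⊨S φ) ⇔ sat3 Trφ (𝒜 T ∷ []))
theorem4 φ = trF φ , λ T → Correctness.translate-correct T φ Correctness.[]
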